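{- There is an absolute constant $c$ such that the following holds. Let $k\ge 1$ and let $G=(V,E)$ be a graph that has a minus-domination function $f$ of size at most $k$. Let $R=\{x\in V: f(x)=-1\}$ and $W=\{x\in V: f(x)=1\}$. Then $|W\cup R|\le c\,k^2$, i.e. $|W\cup R|=O(k^2)$.
   Context: For a graph $G=(V,E)$ and $x\in V$, $N[x]=\{x\}\cup N(x)$ is the closed neighborhood. For $f:V\to\mathbb{Z}$ and $U\subseteq V$, $f(U)=\sum_{x\in U}f(x)$. A function $f:V\to\{ -1,0,1\}$ is a minus-domination function if $f(N[x])>0$ for every $x\in V$. The size of $f$ is the number of vertices $x$ with $f(x)=1$. -}

module Defs where

open import Data.Nat using (ℕ; zero; suc)
import Data.Nat as ℕ
open import Data.Fin using (Fin; zero; suc)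
open import Data.Fin.Properties using (_≟_)
open import Data.Integer using (ℤ; +_; -[1+_]; _>_)
import Data.Integer as ℤ
open import Data.Bool using (Bool; true; false; if_then_else_; _∨_)
open import Relation.Nullary.Decidable using (⌊_⌋)
open import Relation.Binary.PropositionalEquality using (_≡_)

record Graph (n : ℕ) : Set where
  field
    adj    : Fin n → Fin n → Bool
    sym    : ∀ x y → adj x y ≡ adj y x
    irrefl : ∀ x → adj x x ≡ false
open Graph public

data Val : Set where
  neg zer pos : Val

val : Val → ℤ
val neg = -[1+ 0 ]
val zer = + 0
val pos = + 1

sumℤ : ∀ {n} → (Fin n → ℤ) → ℤ
sumℤ {zero}  g = + 0
sumℤ {suc n} g = g zero ℤ.+ sumℤ (λ i → g (suc i))

count : ∀ {n} → (Fin n → Bool) → ℕ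
count {zero}  p = 0
count {suc n} p = (if p zero then 1 else 0) ℕ.+ count (λ i → p (suc i))

inClosedNbhd : ∀ {n} → Graph n → Fin n → Fin n → Bool
inClosedNbhd G x y = ⌊ y ≟ x ⌋ ∨ adj G x y

fN : ∀ {n} → Graph n → (Fin n → Val) → Fin n → ℤ
fN G f x = sumℤ (λ y → if inClosedNbhd G x y then val (f y) else + 0)

IsMinusDomination : ∀ {n} → Graph n → (Fin n → Val) → Set
IsMinusDomination G f = ∀ x → fN G f x > + 0

isPos : Val → Bool
isPos pos = true
isPos _   = false

isNeg : Val → Bool
isNeg neg = true
isNeg _   = false

size : ∀ {n} → (Fin n → Val) → ℕ
size f = count (λ x → isPos (f x))

|W∪R| : ∀ {n} → (Fin n → Val) → ℕ
|W∪R| f = count (λ x → isPos (f x) ∨ isNeg (f x))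

-- Put k = |W|. Domination at x says that N[x] contains more vertices of W
-- than of R. Hence every vertex has at most k neighbours in R, while every
-- vertex of R (which lies in its own closed neighbourhood) has at least two
-- neighbours in W. Counting the edges between R and W both ways gives
-- 2|R| ≤ k², so |W ∪ R| = |W| + |R| ≤ 2k².
module Submission where

open import Defs
open import Data.Nat using (ℕ; _≤_; _*_)
open import Data.Product using (∃-syntax)
open import Data.Fin using (Fin)

open import Function using (_∘_)
open import Data.Nat using (zero; suc; _+_; _<_; z≤n; s≤s; >-nonZero)
open import Data.Nat.Properties
open import Data.Fin using (zero; suc)
import Data.Fin.Properties as Fin
open import Data.Product using (_,_)
open import Data.Integer using (ℤ; +_; +<+)
import Data.Integer as ℤ
import Data.Integer.Properties as ℤ
open import Data.Bool using (Bool; true; false; if_then_else_; _∨_)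
open import Relation.Nullary using (yes; no; contradiction)
open import Relation.Nullary.Decidable using (⌊_⌋)
open import Relation.Binary.PropositionalEquality
  using (_≡_; refl; cong; cong₂; subst; module ≡-Reasoning)
import Relation.Binary.PropositionalEquality as ≡
open import Algebra.Properties.Semiring.Sum +-*-semiring
  using (sum; sum-syntax; sum-cong-≗; ∑-comm; ∑-distrib-+; sum-remove; *-distribˡ-sum; *-distribʳ-sum)
open import Algebra.Properties.CommutativeSemigroup *-commutativeSemigroup
  using (x∙yz≈z∙yx)
open import Algebra.Properties.CommutativeSemigroup ℤ.+-commutativeSemigroup
  using (interchange)

𝟙 : Bool → ℕ
𝟙 b = if b then 1 else 0

𝟙≤1 : ∀ b → 𝟙 b ≤ 1
𝟙≤1 true  = ≤-refl
𝟙≤1 false = z≤n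

𝟙-∨ʳ : ∀ a b → 𝟙 b ≤ 𝟙 (a ∨ b)
𝟙-∨ʳ true  b = 𝟙≤1 b
𝟙-∨ʳ false b = ≤-refl

count≡sum : ∀ {n} (p : Fin n → Bool) → count p ≡ ∑[ i < n ] 𝟙 (p i)
count≡sum {zero}  p = refl
count≡sum {suc n} p = cong (λ s → 𝟙 (p zero) + s) (count≡sum (p ∘ suc))

sum-mono-≤ : ∀ {n} {u v : Fin n → ℕ} → (∀ i → u i ≤ v i) → sum u ≤ sum v
sum-mono-≤ {zero}  u≤v = z≤n
sum-mono-≤ {suc n} u≤v = +-mono-≤ (u≤v zero) (sum-mono-≤ (u≤v ∘ suc))

term≤sum : ∀ {n} (u : Fin n → ℕ) i → u i ≤ sum u
term≤sum {suc n} u i = subst (u i ≤_) (≡.sym (sum-remove {i = i} u)) (m≤m+n (u i) _)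

∑-weighted-swap : ∀ {m n} (M : Fin m → Fin n → ℕ) (u : Fin m → ℕ) (v : Fin n → ℕ) →
  ∑[ x < m ] (u x * ∑[ y < n ] (M x y * v y)) ≡ ∑[ y < n ] (v y * ∑[ x < m ] (M x y * u x))
∑-weighted-swap {m} {n} M u v = begin
  ∑[ x < m ] (u x * ∑[ y < n ] (M x y * v y))   ≡⟨ sum-cong-≗ (λ x → *-distribˡ-sum (u x) (λ y → M x y * v y)) ⟩
  ∑[ x < m ] ∑[ y < n ] (u x * (M x y * v y))   ≡⟨ ∑-comm (λ x y → u x * (M x y * v y)) ⟩
  ∑[ y < n ] ∑[ x < m ] (u x * (M x y * v y))   ≡⟨ sum-cong-≗ (λ y → sum-cong-≗ (λ x → x∙yz≈z∙yx (u x) (M x y) (v y))) ⟩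
  ∑[ y < n ] ∑[ x < m ] (v y * (M x y * u x))   ≡⟨ sum-cong-≗ (λ y → *-distribˡ-sum (v y) (λ x → M x y * u x)) ⟨
  ∑[ y < n ] (v y * ∑[ x < m ] (M x y * u x))   ∎
  where open ≡-Reasoning

-- f(N[x]) = |W ∩ N[x]| − |R ∩ N[x]|, expressed below without integer subtraction.
sumℤ-balance : ∀ {n} (g : Fin n → ℤ) (a c : Fin n → ℕ) →
  (∀ i → g i ℤ.+ + a i ≡ + c i) → sumℤ g ℤ.+ + sum a ≡ + sum c
sumℤ-balance {zero}  g a c h = refl
sumℤ-balance {suc n} g a c h = begin
  (g zero ℤ.+ sumℤ g′) ℤ.+ (+ a zero ℤ.+ + sum a′)  ≡⟨ interchange (g zero) (sumℤ g′) (+ a zero) (+ sum a′) ⟩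
  (g zero ℤ.+ + a zero) ℤ.+ (sumℤ g′ ℤ.+ + sum a′)  ≡⟨ cong₂ ℤ._+_ (h zero) (sumℤ-balance g′ a′ (c ∘ suc) (h ∘ suc)) ⟩
  + c zero ℤ.+ + sum (c ∘ suc)                       ∎
  where
  open ≡-Reasoning
  g′ = g ∘ suc
  a′ = a ∘ suc

masked-val-balance : ∀ b v → (if b then val v else + 0) ℤ.+ + (𝟙 b * 𝟙 (isNeg v)) ≡ + (𝟙 b * 𝟙 (isPos v))
masked-val-balance false v   = refl
masked-val-balance true  neg = refl
masked-val-balance true  zer = refl
masked-val-balance true  pos = refl

positive-offset⇒< : ∀ {z a c} → z ℤ.+ + a ≡ + c → z ℤ.> + 0 → a < c
positive-offset⇒< {+ suc s} {a} z+a≡c _ = subst (suc a ≤_) (ℤ.+-injective z+a≡c) (s≤s (m≤n+m a s))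
positive-offset⇒< {+ zero} _ (+<+ ())

positive-masked-sum⇒more-pos : ∀ {n} (b : Fin n → Bool) (g : Fin n → Val) →
  sumℤ (λ y → if b y then val (g y) else + 0) ℤ.> + 0 →
  ∑[ y < n ] (𝟙 (b y) * 𝟙 (isNeg (g y))) < ∑[ y < n ] (𝟙 (b y) * 𝟙 (isPos (g y)))
positive-masked-sum⇒more-pos b g = positive-offset⇒<
  (sumℤ-balance (λ y → if b y then val (g y) else + 0)
                (λ y → 𝟙 (b y) * 𝟙 (isNeg (g y))) (λ y → 𝟙 (b y) * 𝟙 (isPos (g y)))
                (λ y → masked-val-balance (b y) (g y)))

closedNbhd-self : ∀ {n} (G : Graph n) x → inClosedNbhd G x x ≡ true
closedNbhd-self G x with x Fin.≟ x
... | yes _   = refl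
... | no x≢x = contradiction refl x≢x

module _ {n} (G : Graph n) (f : Fin n → Val) where

  W R : Fin n → ℕ
  W y = 𝟙 (isPos (f y))
  R y = 𝟙 (isNeg (f y))

  A N[_] : Fin n → Fin n → ℕ
  A x y = 𝟙 (adj G x y)
  N[ x ] y = 𝟙 (inClosedNbhd G x y)

  size≡∑W : size f ≡ sum W
  size≡∑W = count≡sum (isPos ∘ f)

  |W∪R|≡size+|R| : |W∪R| f ≡ size f + sum R
  |W∪R|≡size+|R| = begin
    |W∪R| f                                  ≡⟨ count≡sum (λ y → isPos (f y) ∨ isNeg (f y)) ⟩
    ∑[ y < n ] 𝟙 (isPos (f y) ∨ isNeg (f y)) ≡⟨ sum-cong-≗ W∪R-split ⟩
    ∑[ y < n ] (W y + R y)                   ≡⟨ ∑-distrib-+ W R ⟩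
    sum W + sum R                            ≡⟨ cong (_+ sum R) size≡∑W ⟨
    size f + sum R                           ∎
    where
    open ≡-Reasoning
    W∪R-split : ∀ y → 𝟙 (isPos (f y) ∨ isNeg (f y)) ≡ W y + R y
    W∪R-split y with f y
    ... | neg = refl
    ... | zer = refl
    ... | pos = refl

  module _ (dominating : IsMinusDomination G f) where

    closedNbhd-more-pos : ∀ x → ∑[ y < n ] (N[ x ] y * R y) < ∑[ y < n ] (N[ x ] y * W y)
    closedNbhd-more-pos x = positive-masked-sum⇒more-pos (inClosedNbhd G x) f (dominating x)

    adjacent-neg≤size : ∀ x → ∑[ y < n ] (A x y * R y) ≤ size f
    adjacent-neg≤size x = begin
      ∑[ y < n ] (A x y * R y)       ≤⟨ sum-mono-≤ (λ y → *-monoˡ-≤ (R y) (𝟙-∨ʳ (⌊ y Fin.≟ x ⌋) (adj G x y))) ⟩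
      ∑[ y < n ] (N[ x ] y * R y)    <⟨ closedNbhd-more-pos x ⟩
      ∑[ y < n ] (N[ x ] y * W y)    ≤⟨ sum-mono-≤ (λ y → *-monoˡ-≤ (W y) (𝟙≤1 (inClosedNbhd G x y))) ⟩
      ∑[ y < n ] (1 * W y)           ≡⟨ sum-cong-≗ (λ y → *-identityˡ (W y)) ⟩
      sum W                          ≡⟨ size≡∑W ⟨
      size f                         ∎
      where
      open ≤-Reasoning

    neg⇒two-adjacent-pos : ∀ r → f r ≡ neg → 2 ≤ ∑[ y < n ] (A r y * W y)
    neg⇒two-adjacent-pos r fr≡neg = begin
      2                                  ≡⟨ cong suc self-term ⟨
      suc (N[ r ] r * R r)               ≤⟨ s≤s (term≤sum (λ y → N[ r ] y * R y) r) ⟩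
      suc (∑[ y < n ] (N[ r ] y * R y))  ≤⟨ closedNbhd-more-pos r ⟩
      ∑[ y < n ] (N[ r ] y * W y)        ≡⟨ sum-cong-≗ closed≡open ⟩
      ∑[ y < n ] (A r y * W y)           ∎
      where
      open ≤-Reasoning
      self-term : N[ r ] r * R r ≡ 1
      self-term rewrite closedNbhd-self G r | fr≡neg = refl
      closed≡open : ∀ y → N[ r ] y * W y ≡ A r y * W y
      closed≡open y with y Fin.≟ r
      ... | no _ = refl
      ... | yes refl rewrite fr≡neg = ≡.sym (*-zeroʳ (A y y))

    |R|*2≤size² : sum R * 2 ≤ size f * size f
    |R|*2≤size² = begin
      sum R * 2                                    ≡⟨ *-distribʳ-sum 2 R ⟩
      ∑[ x < n ] (R x * 2)                         ≤⟨ sum-mono-≤ two-per-neg ⟩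
      ∑[ x < n ] (R x * ∑[ y < n ] (A x y * W y))  ≡⟨ ∑-weighted-swap A R W ⟩
      ∑[ y < n ] (W y * ∑[ x < n ] (A x y * R x))  ≡⟨ sum-cong-≗ (λ y → cong (W y *_) (adj-transpose y)) ⟩
      ∑[ y < n ] (W y * ∑[ x < n ] (A y x * R x))  ≤⟨ sum-mono-≤ (λ y → *-monoʳ-≤ (W y) (adjacent-neg≤size y)) ⟩
      ∑[ y < n ] (W y * size f)                    ≡⟨ *-distribʳ-sum (size f) W ⟨
      sum W * size f                               ≡⟨ cong (_* size f) size≡∑W ⟨
      size f * size f                              ∎
      where
      open ≤-Reasoning
      adj-transpose : ∀ y → ∑[ x < n ] (A x y * R x) ≡ ∑[ x < n ] (A y x * R x)
      adj-transpose y = sum-cong-≗ (λ x → cong (λ b → 𝟙 b * R x) (Graph.sym G x y))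
      two-per-neg : ∀ x → R x * 2 ≤ R x * ∑[ y < n ] (A x y * W y)
      two-per-neg x with f x in fx≡
      ... | neg = *-monoʳ-≤ 1 (neg⇒two-adjacent-pos x fx≡)
      ... | zer = z≤n
      ... | pos = z≤n

mainTheorem2 : ∃[ c ] (∀ (k : ℕ) → 1 ≤ k → ∀ (n : ℕ) (G : Graph n) (f : Fin n → Val) →
    IsMinusDomination G f → size f ≤ k → |W∪R| f ≤ c * (k * k))
mainTheorem2 = 2 , λ k 1≤k n G f dominating size≤k →
  let open ≤-Reasoning
      |R| = sum (R G f)
      k≤k² = m≤m*n k k {{>-nonZero 1≤k}}
      size²≤k² = *-mono-≤ size≤k size≤k
  in begin
    |W∪R| f        ≡⟨ |W∪R|≡size+|R| G f ⟩
    size f + |R|   ≤⟨ +-mono-≤ (≤-trans size≤k k≤k²)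
                               (≤-trans (m≤m*n |R| 2) (≤-trans (|R|*2≤size² G f dominating) size²≤k²)) ⟩
    k * k + k * k  ≡⟨ cong (λ s → k * k + s) (+-identityʳ (k * k)) ⟨
    2 * (k * k)    ∎
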